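{- Let $G=(V,E)$ be a graph. The set of matchings $M(G)$ is the intersection of two matroids on $E$ if and only if $G$ contains no odd cycle of length at least $5$ and every triangle of $G$ has at most one vertex whose degree in $G$ is greater than $2$.
   Context: Graphs are finite, undirected, without loops or multiple edges. A matroid on a finite set $S$ is a family $\mathcal{M}$ of subsets of $S$ with $\emptyset\in\mathcal{M}$, closed under subsets, such that for every $A\subseteq S$ all maximal members of $\mathcal{M}$ contained in $A$ have the same cardinality. $M(G)$ denotes the family of all matchings of $G$ (sets of pairwise disjoint edges), as a family of subsets of $E$. The intersection of matroids $\mathcal{M}_1,\mathcal{M}_2$ on $E$ is $\mathcal{M}_1\cap\mathcal{M}_2$. A cycle of $G$ means a (not necessarily induced) cycle subgraph; a triangle is a cycle of length $3$. -}

module Defs where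

open import Data.Nat using (ℕ; zero; suc; _<_; _≤_; _%_)
open import Data.Fin using (Fin; zero; suc; inject₁; fromℕ; _≟_)
open import Data.Fin.Subset using (Subset; _∈_; _⊆_; ∣_∣; ⊥)
open import Data.Vec using (tabulate)
open import Data.Bool using (Bool; true; false; _∨_)
open import Data.Product using (_×_; _,_; proj₁; proj₂; Σ; ∃; ∃-syntax)
open import Data.Sum using (_⊎_)
open import Relation.Binary.PropositionalEquality using (_≡_; _≢_)
open import Relation.Nullary using (¬_)
open import Relation.Nullary.Decidable using (⌊_⌋)
open import Function.Definitions using (Injective)

record Graph : Set where
  field
    n      : ℕ
    m      : ℕ
    ends   : Fin m → Fin n × Fin n
    noLoop : ∀ e → proj₁ (ends e) ≢ proj₂ (ends e)
    noMulti : ∀ e f →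
      (ends e ≡ ends f ⊎ (proj₁ (ends e) ≡ proj₂ (ends f) × proj₂ (ends e) ≡ proj₁ (ends f))) →
      e ≡ f

open Graph public

Vertex : Graph → Set
Vertex G = Fin (n G)

EdgeIx : Graph → Set
EdgeIx G = Fin (m G)

EdgeSet : Graph → Set
EdgeSet G = Subset (m G)

incident : (G : Graph) → Vertex G → EdgeIx G → Bool
incident G v e = ⌊ proj₁ (ends G e) ≟ v ⌋ ∨ ⌊ proj₂ (ends G e) ≟ v ⌋

Adjacent : (G : Graph) → Vertex G → Vertex G → Set
Adjacent G u v = ∃[ e ] (ends G e ≡ (u , v) ⊎ ends G e ≡ (v , u))

degree : (G : Graph) → Vertex G → ℕ
degree G v = ∣ tabulate (incident G v) ∣

IsMatching : (G : Graph) → EdgeSet G → Set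
IsMatching G A = ∀ e f → e ∈ A → f ∈ A → e ≢ f →
  ∀ v → ¬ (incident G v e ≡ true × incident G v f ≡ true)

Family : ℕ → Set₁
Family m = Subset m → Set

MaximalIn : ∀ {m} → Family m → Subset m → Subset m → Set
MaximalIn F X A = A ⊆ X × F A × (∀ C → A ⊆ C → C ⊆ X → F C → C ≡ A)

record IsMatroid {m : ℕ} (F : Family m) : Set where
  field
    empty     : F ⊥
    hereditary : ∀ A B → F A → B ⊆ A → F B
    equicard  : ∀ X A B → MaximalIn F X A → MaximalIn F X B → ∣ A ∣ ≡ ∣ B ∣

MatchingsIntersectionOfTwoMatroids : Graph → Set₁
MatchingsIntersectionOfTwoMatroids G =
  Σ (Family (m G)) λ M₁ → Σ (Family (m G)) λ M₂ →
    IsMatroid M₁ × IsMatroid M₂ ×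
    (∀ A → (IsMatching G A → M₁ A × M₂ A) × (M₁ A × M₂ A → IsMatching G A))

record Cycle (G : Graph) (len : ℕ) : Set where
  field
    p       : ℕ
    len≡    : len ≡ suc p
    len≥3   : 3 ≤ len
    vtx     : Fin (suc p) → Vertex G
    inj     : Injective _≡_ _≡_ vtx
    step    : ∀ (i : Fin p) → Adjacent G (vtx (inject₁ i)) (vtx (suc i))
    close   : Adjacent G (vtx (fromℕ p)) (vtx zero)

open Cycle public

NoLongOddCycle : Graph → Set
NoLongOddCycle G = ∀ len → 5 ≤ len → len % 2 ≡ 1 → ¬ Cycle G len

TriangleCondition : Graph → Set
TriangleCondition G = ∀ (t : Cycle G 3) (i j : Fin (suc (p t))) →
  2 < degree G (vtx t i) → 2 < degree G (vtx t j) → i ≡ j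

-- If M₁ ∩ M₂ is the family of matchings, each Mᵢ contains all singletons and all pairs of
-- disjoint edges, while no pair of adjacent edges lies in both. Given an independent pair {y,p} and an
-- edge x, equicardinality of maximal independent subsets of {x,y,p} puts {x,y} or {x,p} into Mᵢ.
-- Around an odd cycle of length ≥ 5 this makes membership of consecutive edge pairs in M₁ alternate
-- with odd period, which is impossible; at a triangle with two corners of degree ≥ 3, the extra edges
-- at those corners lead to a similar contradiction.
--
-- Call a triangle edge special when both its ends have degree ≤ 2 and it is opposite the
-- triangle's apex: its unique corner of degree ≥ 3, or else its least corner. Removing the special edges
-- leaves no odd closed walk (a shortest one would be an odd cycle, and every triangle has lost an edge),
-- so the vertices have a 2-colouring that is proper off the special edges. For each colour s, the block
-- of an edge is its end of colour s (or the edge itself if it has none), except that the two ends of a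
-- special edge are identified: their only other edges both run to the apex, so edges at the two ends
-- always meet. The two resulting partition matroids have exactly the matchings as common independent sets.

module Submission where

open import Defs
open import Data.Bool using (Bool; true; false) renaming (_≟_ to _≟ᵇ_)
open import Data.Empty using (⊥; ⊥-elim)
open import Data.Fin using (Fin; zero; suc; toℕ; fromℕ; inject₁)
  renaming (_≟_ to _≟ᶠ_; _≤_ to _≤ᶠ_; _<_ to _<ᶠ_)
open import Data.Fin.Properties using (any?; all?; toℕ-injective; toℕ-fromℕ; toℕ-fromℕ<; toℕ-inject₁; toℕ<n)
  renaming (_<?_ to _<?ᶠ_; <-cmp to <-cmpᶠ; <-trans to <-transᶠ; <-asym to <-asymᶠ; ≤-antisym to ≤-antisymᶠ)
open import Data.Fin.Subset using (Subset; _∈_; _∉_; _⊆_; ∣_∣; ⁅_⁆; _∪_; _─_; _-_; inside; outside)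
open import Data.Fin.Subset.Properties
  using (_∈?_; ∉⊥; x∈⁅x⁆; x∈⁅y⁆⇒x≡y; x∈p∪q⁻; x∈p∪q⁺; ∣⁅x⁆∣≡1; p─⊥≡p; p─q⊆p; x∈p∧x≢y⇒x∈p-y; x∈p⇒∣p-x∣<∣p∣;
         nonempty?; Empty-unique; ∣⊥∣≡0; ⊆-antisym; ∪-comm; ∪-idem; anySubset?)
open import Data.List using (List; []; _∷_; _++_; length; lookup)
open import Data.List.Properties using (length-++)
open import Data.Nat using (ℕ; zero; suc; _+_; _*_; _≤_; _<_; z≤n; s≤s; _%_; _/_; NonZero; parity)
open import Data.Nat.DivMod
  using (_mod_; m≡m%n+[m/n]*n; [m+kn]%n≡m%n; [m+n]%n≡m%n; n%n≡0; m%n<n; %-distribˡ-+; m<n⇒m%n≡m)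
open import Data.Nat.Properties
  using (≤-refl; ≤-trans; ≤-reflexive; ≤-pred; n≤1+n; ≤-antisym; n≮0; <-irrefl; <⇒≱; ≤⇒≯; ≰⇒>; _≤?_; _<?_;
         suc-injective; +-comm; +-cancelˡ-≡; m≤m+n; m<m+n; m<n+m; module ≤-Reasoning)
open import Data.Nat.Solver using (module +-*-Solver)
open import Data.Parity using (Parity; 0ℙ; 1ℙ; _⁻¹) renaming (_+_ to _ℙ+_)
open import Data.Parity.Properties using (⁻¹-involutive; suc-homo-⁻¹; +-homo-+; p+p⁻¹≡1ℙ)
open import Data.Product using (∃; _×_; _,_; proj₁; proj₂)
open import Data.Product.Properties using (×-≡,≡→≡; ≡-dec)
open import Data.Sum using (_⊎_; inj₁; inj₂; swap)
open import Data.Sum.Properties using (inj₂-injective) renaming (≡-dec to ≡-decˢ)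
open import Data.Unit using (⊤; tt)
open import Data.Vec using (_∷_; here; there; tabulate) renaming (lookup to lookupᵛ)
open import Data.Vec.Properties using (lookup⇒[]=; []=⇒lookup; lookup∘tabulate)
open import Function using (_∘_; _⇔_; Equivalence; mk⇔)
open import Relation.Binary.Definitions using (DecidableEquality; tri<; tri≈; tri>)
open import Relation.Binary.PropositionalEquality
open import Relation.Nullary using (¬_; Dec; yes; no; contradiction)
open import Relation.Nullary.Decidable using (map′; isYes; ¬?; _→-dec_; _×-dec_; _⊎-dec_; ¬¬-excluded-middle)

open +-*-Solver using (solve; _:=_; _:+_; con)

∣p∣≤1+∣p-x∣ : ∀ {n} (p : Subset n) (x : Fin n) → ∣ p ∣ ≤ suc ∣ p - x ∣
∣p∣≤1+∣p-x∣ (inside ∷ p) zero = s≤s (≤-reflexive (cong ∣_∣ (sym (p─⊥≡p p))))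
∣p∣≤1+∣p-x∣ (outside ∷ p) zero = ≤-trans (n≤1+n _) (s≤s (≤-reflexive (cong ∣_∣ (sym (p─⊥≡p p)))))
∣p∣≤1+∣p-x∣ (inside ∷ p) (suc x) = s≤s (∣p∣≤1+∣p-x∣ p x)
∣p∣≤1+∣p-x∣ (outside ∷ p) (suc x) = ∣p∣≤1+∣p-x∣ p x

x∈p─q⇒x∉q : ∀ {n} {x : Fin n} (p q : Subset n) → x ∈ p ─ q → x ∉ q
x∈p─q⇒x∉q (inside ∷ p) (outside ∷ q) here ()
x∈p─q⇒x∉q (_ ∷ p) (_ ∷ q) (there x∈p─q) (there x∈q) = x∈p─q⇒x∉q p q x∈p─q x∈q

x∈p-y⇒x≢y : ∀ {n} {x y : Fin n} (p : Subset n) → x ∈ p - y → x ≢ y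
x∈p-y⇒x≢y {y = y} p x∈p-y refl = x∈p─q⇒x∉q p ⁅ y ⁆ x∈p-y (x∈⁅x⁆ y)

x∈p⇒0<∣p∣ : ∀ {n} {x : Fin n} {p : Subset n} → x ∈ p → 0 < ∣ p ∣
x∈p⇒0<∣p∣ x∈p = ≤-trans (s≤s z≤n) (x∈p⇒∣p-x∣<∣p∣ x∈p)

distinct⇒1<∣p∣ : ∀ {n} {x y : Fin n} {p : Subset n} → x ∈ p → y ∈ p → x ≢ y → 1 < ∣ p ∣
distinct⇒1<∣p∣ x∈p y∈p x≢y =
  ≤-trans (s≤s (x∈p⇒0<∣p∣ (x∈p∧x≢y⇒x∈p-y y∈p (x≢y ∘ sym)))) (x∈p⇒∣p-x∣<∣p∣ x∈p)

distinct⇒2<∣p∣ : ∀ {n} {x y z : Fin n} {p : Subset n} → x ∈ p → y ∈ p → z ∈ p →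
  x ≢ y → x ≢ z → y ≢ z → 2 < ∣ p ∣
distinct⇒2<∣p∣ x∈p y∈p z∈p x≢y x≢z y≢z =
  ≤-trans (s≤s (distinct⇒1<∣p∣ (x∈p∧x≢y⇒x∈p-y y∈p (x≢y ∘ sym)) (x∈p∧x≢y⇒x∈p-y z∈p (x≢z ∘ sym)) y≢z))
          (x∈p⇒∣p-x∣<∣p∣ x∈p)

injectiveOn⇒∣p∣≤∣q∣ : ∀ {m n} (f : Fin m → Fin n) {p : Subset m} {q : Subset n} →
  (∀ {x} → x ∈ p → f x ∈ q) → (∀ {x y} → x ∈ p → y ∈ p → f x ≡ f y → x ≡ y) → ∣ p ∣ ≤ ∣ q ∣
injectiveOn⇒∣p∣≤∣q∣ {m} f {p} = bounded ∣ p ∣ ≤-refl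
  where
  bounded : ∀ k {p : Subset m} {q} → ∣ p ∣ ≤ k → (∀ {x} → x ∈ p → f x ∈ q) →
    (∀ {x y} → x ∈ p → y ∈ p → f x ≡ f y → x ≡ y) → ∣ p ∣ ≤ ∣ q ∣
  bounded k {p} ∣p∣≤k maps inj with nonempty? p
  ... | no ¬nonempty = ≤-trans (≤-reflexive (trans (cong ∣_∣ (Empty-unique ¬nonempty)) (∣⊥∣≡0 m))) z≤n
  bounded zero ∣p∣≤0 maps inj | yes (x , x∈p) = ⊥-elim (n≮0 (≤-trans (x∈p⇒0<∣p∣ x∈p) ∣p∣≤0))
  bounded (suc k) {p} {q} ∣p∣≤k maps inj | yes (x , x∈p) = begin
    ∣ p ∣             ≤⟨ ∣p∣≤1+∣p-x∣ p x ⟩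
    suc ∣ p - x ∣     ≤⟨ s≤s (bounded k (≤-pred (≤-trans (x∈p⇒∣p-x∣<∣p∣ x∈p) ∣p∣≤k)) maps′ inj′) ⟩
    suc ∣ q - f x ∣   ≤⟨ x∈p⇒∣p-x∣<∣p∣ (maps x∈p) ⟩
    ∣ q ∣             ∎
    where
    open ≤-Reasoning
    maps′ : ∀ {y} → y ∈ p - x → f y ∈ q - f x
    maps′ {y} y∈p-x = x∈p∧x≢y⇒x∈p-y (maps (p─q⊆p p _ y∈p-x))
      (λ fy≡fx → x∈p-y⇒x≢y p y∈p-x (inj (p─q⊆p p _ y∈p-x) x∈p fy≡fx))
    inj′ : ∀ {y z} → y ∈ p - x → z ∈ p - x → f y ≡ f z → y ≡ z
    inj′ y∈ z∈ = inj (p─q⊆p p _ y∈) (p─q⊆p p _ z∈)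

PartitionMatroid : ∀ {m} {K : Set} → (Fin m → K) → Family m
PartitionMatroid κ A = ∀ {e f} → e ∈ A → f ∈ A → κ e ≡ κ f → e ≡ f

module _ {m} {K : Set} (_≟_ : DecidableEquality K) (κ : Fin m → K) where

  private
    Meets : Subset m → Fin m → Set
    Meets B e = ∃ λ b → b ∈ B × κ b ≡ κ e

    pick : Subset m → Fin m → Fin m
    pick B e with any? (λ b → (b ∈? B) ×-dec (κ b ≟ κ e))
    ... | yes (b , _) = b
    ... | no _ = e

    pick-meets : ∀ {B e} → Meets B e → pick B e ∈ B × κ (pick B e) ≡ κ e
    pick-meets {B} {e} meets with any? (λ b → (b ∈? B) ×-dec (κ b ≟ κ e))
    ... | yes (_ , b∈B×κb≡κe) = b∈B×κb≡κe
    ... | no ¬meets = ⊥-elim (¬meets meets)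

    maximal-meets : ∀ {X B e} → MaximalIn (PartitionMatroid κ) X B → e ∈ X → Meets B e
    maximal-meets {X} {B} {e} (B⊆X , indepB , maximal) e∈X
      with any? (λ b → (b ∈? B) ×-dec (κ b ≟ κ e))
    ... | yes meets = meets
    ... | no ¬meets = ⊥-elim (¬meets (e , e∈B , refl))
      where
      B+e = B ∪ ⁅ e ⁆
      B+e⊆X : B+e ⊆ X
      B+e⊆X h with x∈p∪q⁻ B ⁅ e ⁆ h
      ... | inj₁ b∈B = B⊆X b∈B
      ... | inj₂ b∈⁅e⁆ rewrite x∈⁅y⁆⇒x≡y e b∈⁅e⁆ = e∈X
      indepB+e : PartitionMatroid κ B+e
      indepB+e {u} {v} u∈ v∈ κu≡κv with x∈p∪q⁻ B ⁅ e ⁆ u∈ | x∈p∪q⁻ B ⁅ e ⁆ v∈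
      ... | inj₁ u∈B | inj₁ v∈B = indepB u∈B v∈B κu≡κv
      ... | inj₁ u∈B | inj₂ v∈⁅e⁆ rewrite x∈⁅y⁆⇒x≡y e v∈⁅e⁆ = ⊥-elim (¬meets (u , u∈B , κu≡κv))
      ... | inj₂ u∈⁅e⁆ | inj₁ v∈B rewrite x∈⁅y⁆⇒x≡y e u∈⁅e⁆ = ⊥-elim (¬meets (v , v∈B , sym κu≡κv))
      ... | inj₂ u∈⁅e⁆ | inj₂ v∈⁅e⁆ = trans (x∈⁅y⁆⇒x≡y e u∈⁅e⁆) (sym (x∈⁅y⁆⇒x≡y e v∈⁅e⁆))
      e∈B : e ∈ B
      e∈B = subst (e ∈_) (maximal B+e (λ h → x∈p∪q⁺ (inj₁ h)) B+e⊆X indepB+e) (x∈p∪q⁺ (inj₂ (x∈⁅x⁆ e)))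

    maximal-≤ : ∀ {X A B} → MaximalIn (PartitionMatroid κ) X A → MaximalIn (PartitionMatroid κ) X B →
      ∣ A ∣ ≤ ∣ B ∣
    maximal-≤ {A = A} {B = B} (A⊆X , indepA , _) maxB = injectiveOn⇒∣p∣≤∣q∣ (pick B)
      (λ x∈A → proj₁ (pick-meets (maximal-meets maxB (A⊆X x∈A))))
      (λ x∈A y∈A px≡py → indepA x∈A y∈A (trans (sym (κ-pick x∈A)) (trans (cong κ px≡py) (κ-pick y∈A))))
      where
      κ-pick : ∀ {x} → x ∈ A → κ (pick B x) ≡ κ x
      κ-pick x∈A = proj₂ (pick-meets (maximal-meets maxB (A⊆X x∈A)))

  partitionMatroid-isMatroid : IsMatroid (PartitionMatroid κ)
  partitionMatroid-isMatroid = record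
    { empty      = λ e∈⊥ → ⊥-elim (∉⊥ e∈⊥)
    ; hereditary = λ A B indepA B⊆A e∈B f∈B → indepA (B⊆A e∈B) (B⊆A f∈B)
    ; equicard   = λ X A B maxA maxB → ≤-antisym (maximal-≤ maxA maxB) (maximal-≤ maxB maxA)
    }

pair : ∀ {m} → Fin m → Fin m → Subset m
pair a b = ⁅ a ⁆ ∪ ⁅ b ⁆

∈pairˡ : ∀ {m} (a b : Fin m) → a ∈ pair a b
∈pairˡ a b = x∈p∪q⁺ (inj₁ (x∈⁅x⁆ a))

∈pairʳ : ∀ {m} (a b : Fin m) → b ∈ pair a b
∈pairʳ a b = x∈p∪q⁺ (inj₂ (x∈⁅x⁆ b))

∈pair⁻ : ∀ {m} {a b x : Fin m} → x ∈ pair a b → x ≡ a ⊎ x ≡ b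
∈pair⁻ {a = a} {b} x∈ with x∈p∪q⁻ ⁅ a ⁆ ⁅ b ⁆ x∈
... | inj₁ x∈⁅a⁆ = inj₁ (x∈⁅y⁆⇒x≡y a x∈⁅a⁆)
... | inj₂ x∈⁅b⁆ = inj₂ (x∈⁅y⁆⇒x≡y b x∈⁅b⁆)

pair⊆ : ∀ {m} {a b : Fin m} {C : Subset m} → a ∈ C → b ∈ C → pair a b ⊆ C
pair⊆ a∈C b∈C x∈ with ∈pair⁻ x∈
... | inj₁ refl = a∈C
... | inj₂ refl = b∈C

module _ {m} {M : Family m} (isMatroid : IsMatroid M) where
  open IsMatroid isMatroid

  pair-sym : ∀ {a b} → M (pair a b) → M (pair b a)
  pair-sym {a} {b} = subst M (∪-comm ⁅ a ⁆ ⁅ b ⁆)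

  -- Both {y,p} and {x} are maximal independent in {x,y,p}, against equicardinality.
  pair-augment : ∀ {x y p} → y ≢ p → M ⁅ x ⁆ → M (pair y p) → ¬ M (pair x y) → ¬ M (pair x p) → ⊥
  pair-augment {x} {y} {p} y≢p indep-x indep-yp ¬xy ¬xp =
    <-irrefl (trans (sym (∣⁅x⁆∣≡1 x)) (equicard X ⁅ x ⁆ (pair y p) maximal-x maximal-yp))
             (distinct⇒1<∣p∣ (∈pairˡ y p) (∈pairʳ y p) y≢p)
    where
    X = pair y p ∪ ⁅ x ⁆
    X⁻ : ∀ {z} → z ∈ X → z ≡ y ⊎ z ≡ p ⊎ z ≡ x
    X⁻ z∈X with x∈p∪q⁻ (pair y p) ⁅ x ⁆ z∈X
    ... | inj₂ z∈⁅x⁆ = inj₂ (inj₂ (x∈⁅y⁆⇒x≡y x z∈⁅x⁆))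
    ... | inj₁ z∈yp with ∈pair⁻ z∈yp
    ... | inj₁ z≡y = inj₁ z≡y
    ... | inj₂ z≡p = inj₂ (inj₁ z≡p)
    maximal-yp : MaximalIn M X (pair y p)
    maximal-yp = (λ h → x∈p∪q⁺ (inj₁ h)) , indep-yp ,
      λ C yp⊆C C⊆X indepC → ⊆-antisym (C⊆yp C yp⊆C C⊆X indepC) yp⊆C
      where
      C⊆yp : ∀ C → pair y p ⊆ C → C ⊆ X → M C → C ⊆ pair y p
      C⊆yp C yp⊆C C⊆X indepC z∈C with X⁻ (C⊆X z∈C)
      ... | inj₁ refl = ∈pairˡ y p
      ... | inj₂ (inj₁ refl) = ∈pairʳ y p
      ... | inj₂ (inj₂ refl) = ⊥-elim (¬xy (hereditary C _ indepC (pair⊆ z∈C (yp⊆C (∈pairˡ y p)))))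
    maximal-x : MaximalIn M X ⁅ x ⁆
    maximal-x = (λ h → x∈p∪q⁺ (inj₂ h)) , indep-x ,
      λ C x⊆C C⊆X indepC → ⊆-antisym (C⊆x C x⊆C C⊆X indepC) x⊆C
      where
      C⊆x : ∀ C → ⁅ x ⁆ ⊆ C → C ⊆ X → M C → C ⊆ ⁅ x ⁆
      C⊆x C x⊆C C⊆X indepC z∈C with X⁻ (C⊆X z∈C)
      ... | inj₁ refl = ⊥-elim (¬xy (hereditary C _ indepC (pair⊆ (x⊆C (x∈⁅x⁆ x)) z∈C)))
      ... | inj₂ (inj₁ refl) = ⊥-elim (¬xp (hereditary C _ indepC (pair⊆ (x⊆C (x∈⁅x⁆ x)) z∈C)))
      ... | inj₂ (inj₂ refl) = x∈⁅x⁆ x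

-- At every index one of A, B fails and neither fails twice in a row, so A holds at every
-- other index; hence it cannot be periodic with odd period.
no-odd-alternation : (A B : ℕ → Set) → (∀ k → ¬ (A k × B k)) →
  (∀ k → ¬ A k → ¬ A (suc k) → ⊥) → (∀ k → ¬ B k → ¬ B (suc k) → ⊥) →
  ∀ j → A (suc (j * 2)) ⇔ A 0 → ⊥
no-odd-alternation A B exclusive A-no-gap B-no-gap j period = ¬¬a₀ (flip⁻ (j * 2) (even⁺ j ¬¬a₀) ∘ from)
  where
  open Equivalence period
  flip⁺ : ∀ k → ¬ A k → ¬ ¬ A (suc k)
  flip⁺ = A-no-gap
  flip⁻ : ∀ k → ¬ ¬ A k → ¬ A (suc k)
  flip⁻ k ¬¬a a′ = ¬¬a (λ a → B-no-gap k (λ b → exclusive k (a , b)) (λ b′ → exclusive (suc k) (a′ , b′)))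
  even⁻ : ∀ i → ¬ A 0 → ¬ A (i * 2)
  even⁻ zero ¬a₀ = ¬a₀
  even⁻ (suc i) ¬a₀ = flip⁻ (suc (i * 2)) (flip⁺ (i * 2) (even⁻ i ¬a₀))
  even⁺ : ∀ i → ¬ ¬ A 0 → ¬ ¬ A (i * 2)
  even⁺ zero ¬¬a₀ = ¬¬a₀
  even⁺ (suc i) ¬¬a₀ = flip⁺ (suc (i * 2)) (flip⁻ (i * 2) (even⁺ i ¬¬a₀))
  ¬¬a₀ : ¬ ¬ A 0
  ¬¬a₀ ¬a₀ = flip⁺ (j * 2) (even⁻ j ¬a₀) (¬a₀ ∘ to)

OnlyIn : ∀ {m} → Family m → Family m → Family m
OnlyIn M M′ A = M A × ¬ M′ A

module CommonIndependent {m} {M₁ M₂ : Family m} (isM₁ : IsMatroid M₁) (isM₂ : IsMatroid M₂)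
  (singleton : ∀ e → M₁ ⁅ e ⁆ × M₂ ⁅ e ⁆) where

  Conflict : Fin m → Fin m → Set
  Conflict u v = ¬ (M₁ (pair u v) × M₂ (pair u v))

  conflict-sym : ∀ {u v} → Conflict u v → Conflict v u
  conflict-sym c (i₁ , i₂) = c (pair-sym isM₁ i₁ , pair-sym isM₂ i₂)

  conflict⇒≢ : ∀ {u v} → Conflict u v → u ≢ v
  conflict⇒≢ {u} c refl rewrite ∪-idem ⁅ u ⁆ = c (singleton u)

  ¬pair-sym : ∀ {M : Family m} → IsMatroid M → ∀ {u v} → ¬ M (pair u v) → ¬ M (pair v u)
  ¬pair-sym isM ¬uv = ¬uv ∘ pair-sym isM

  Separated : Fin m → Fin m → Fin m → Set
  Separated x a b = OnlyIn M₁ M₂ (pair x a) × OnlyIn M₂ M₁ (pair x b)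

  ¬separated-triangle : ∀ {x a b} → Conflict x a → Conflict x b → Conflict a b → ¬ Separated x a b
  ¬separated-triangle {x} {a} {b} cxa cxb cab ((i₁xa , ¬i₂xa) , (i₂xb , ¬i₁xb)) =
    ¬¬-excluded-middle λ where
      (yes i₁ab) → pair-augment isM₂ (conflict⇒≢ cxb) (proj₂ (singleton a)) i₂xb
                     (¬pair-sym isM₂ ¬i₂xa) (λ i₂ab → cab (i₁ab , i₂ab))
      (no ¬i₁ab) → pair-augment isM₁ (conflict⇒≢ cxa) (proj₁ (singleton b)) i₁xa
                     (¬pair-sym isM₁ ¬i₁xb) (¬pair-sym isM₁ ¬i₁ab)

  separates : ∀ {x y p} → Conflict x y → Conflict x p → y ≢ p → M₁ (pair y p) → M₂ (pair y p) →
    ¬ ¬ (Separated x y p ⊎ Separated x p y)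
  separates {x} {y} {p} cxy cxp y≢p i₁yp i₂yp goal =
    ¬¬-excluded-middle λ where
      (yes i₁xy) → ¬¬-excluded-middle λ where
        (yes i₂xp) → goal (inj₁ ((i₁xy , λ i₂xy → cxy (i₁xy , i₂xy)) , (i₂xp , λ i₁xp → cxp (i₁xp , i₂xp))))
        (no ¬i₂xp) → augment₂ (λ i₂xy → cxy (i₁xy , i₂xy)) ¬i₂xp
      (no ¬i₁xy) → ¬¬-excluded-middle λ where
        (yes i₁xp) → ¬¬-excluded-middle λ where
          (yes i₂xy) → goal (inj₂ ((i₁xp , λ i₂xp → cxp (i₁xp , i₂xp)) , (i₂xy , ¬i₁xy)))
          (no ¬i₂xy) → augment₂ ¬i₂xy (λ i₂xp → cxp (i₁xp , i₂xp))
        (no ¬i₁xp) → pair-augment isM₁ y≢p (proj₁ (singleton x)) i₁yp ¬i₁xy ¬i₁xp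
    where
    augment₂ : ¬ M₂ (pair x y) → ¬ M₂ (pair x p) → ⊥
    augment₂ = pair-augment isM₂ y≢p (proj₂ (singleton x)) i₂yp

  -- x, y, z are the edges of a triangle; p and q are further edges at the corners x ∩ z and x ∩ y.
  five-edge-obstruction : ∀ {x y z p q} → Conflict x y → Conflict x z → Conflict x p → Conflict x q →
    Conflict y z → Conflict z p → Conflict q y →
    y ≢ p → M₁ (pair y p) → M₂ (pair y p) → z ≢ q → M₁ (pair z q) → M₂ (pair z q) → ⊥
  five-edge-obstruction {x} {y} {z} {p} {q} cxy cxz cxp cxq cyz czp cqy y≢p i₁yp i₂yp z≢q i₁zq i₂zq =
    separates cxy cxp y≢p i₁yp i₂yp λ s₁ → separates cxz cxq z≢q i₁zq i₂zq λ s₂ → cases s₁ s₂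
    where
    cases : Separated x y p ⊎ Separated x p y → Separated x z q ⊎ Separated x q z → ⊥
    cases (inj₁ (y₁ , _)) (inj₁ (_ , q₂)) = ¬separated-triangle cxy cxq (conflict-sym cqy) (y₁ , q₂)
    cases (inj₁ (y₁ , _)) (inj₂ (_ , z₂)) = ¬separated-triangle cxy cxz cyz (y₁ , z₂)
    cases (inj₂ (_ , y₂)) (inj₁ (z₁ , _)) = ¬separated-triangle cxz cxy (conflict-sym cyz) (z₁ , y₂)
    cases (inj₂ (p₁ , _)) (inj₂ (_ , z₂)) = ¬separated-triangle cxp cxz (conflict-sym czp) (p₁ , z₂)

module Incidence (G : Graph) where

  end₁ end₂ : EdgeIx G → Vertex G
  end₁ e = proj₁ (ends G e)
  end₂ e = proj₂ (ends G e)

  infix 4 _∈ₑ_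
  _∈ₑ_ : Vertex G → EdgeIx G → Set
  v ∈ₑ e = end₁ e ≡ v ⊎ end₂ e ≡ v

  _∈ₑ?_ : ∀ v e → Dec (v ∈ₑ e)
  v ∈ₑ? e = (end₁ e ≟ᶠ v) ⊎-dec (end₂ e ≟ᶠ v)

  incident⇒∈ₑ : ∀ {v e} → incident G v e ≡ true → v ∈ₑ e
  incident⇒∈ₑ {v} {e} h with end₁ e ≟ᶠ v | end₂ e ≟ᶠ v
  ... | yes end₁≡v | _ = inj₁ end₁≡v
  ... | no _ | yes end₂≡v = inj₂ end₂≡v

  ∈ₑ⇒incident : ∀ {v e} → v ∈ₑ e → incident G v e ≡ true
  ∈ₑ⇒incident {v} {e} v∈ₑe with end₁ e ≟ᶠ v | end₂ e ≟ᶠ v | v∈ₑe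
  ... | yes _ | _ | _ = refl
  ... | no _ | yes _ | _ = refl
  ... | no end₁≢v | no _ | inj₁ end₁≡v = contradiction end₁≡v end₁≢v
  ... | no _ | no end₂≢v | inj₂ end₂≡v = contradiction end₂≡v end₂≢v

  joins⇒∈ₑ : ∀ {u v} e → ends G e ≡ (u , v) ⊎ ends G e ≡ (v , u) → u ∈ₑ e × v ∈ₑ e
  joins⇒∈ₑ e (inj₁ e≡uv) = inj₁ (cong proj₁ e≡uv) , inj₂ (cong proj₂ e≡uv)
  joins⇒∈ₑ e (inj₂ e≡vu) = inj₂ (cong proj₂ e≡vu) , inj₁ (cong proj₁ e≡vu)

  Adjacent-sym : ∀ {u v} → Adjacent G u v → Adjacent G v u
  Adjacent-sym (e , inj₁ e≡uv) = e , inj₂ e≡uv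
  Adjacent-sym (e , inj₂ e≡vu) = e , inj₁ e≡vu

  Adjacent⇒≢ : ∀ {u v} → Adjacent G u v → u ≢ v
  Adjacent⇒≢ (e , inj₁ e≡uv) refl = noLoop G e (trans (cong proj₁ e≡uv) (sym (cong proj₂ e≡uv)))
  Adjacent⇒≢ (e , inj₂ e≡vu) refl = noLoop G e (trans (cong proj₁ e≡vu) (sym (cong proj₂ e≡vu)))

  only-two-ends : ∀ {a b c e} → a ≢ b → a ∈ₑ e → b ∈ₑ e → c ∈ₑ e → c ≡ a ⊎ c ≡ b
  only-two-ends a≢b (inj₁ refl) (inj₁ refl) _ = contradiction refl a≢b
  only-two-ends a≢b (inj₂ refl) (inj₂ refl) _ = contradiction refl a≢b
  only-two-ends _ (inj₁ refl) (inj₂ refl) (inj₁ refl) = inj₁ refl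
  only-two-ends _ (inj₁ refl) (inj₂ refl) (inj₂ refl) = inj₂ refl
  only-two-ends _ (inj₂ refl) (inj₁ refl) (inj₁ refl) = inj₂ refl
  only-two-ends _ (inj₂ refl) (inj₁ refl) (inj₂ refl) = inj₁ refl

  third-end⇒≢ : ∀ {a b c e f} → a ≢ b → a ∈ₑ e → b ∈ₑ e → c ∈ₑ f → c ≢ a → c ≢ b → e ≢ f
  third-end⇒≢ a≢b a∈e b∈e c∈f c≢a c≢b refl with only-two-ends a≢b a∈e b∈e c∈f
  ... | inj₁ c≡a = c≢a c≡a
  ... | inj₂ c≡b = c≢b c≡b

  common-ends⇒≡ : ∀ {u v e f} → u ≢ v → u ∈ₑ e → v ∈ₑ e → u ∈ₑ f → v ∈ₑ f → e ≡ f
  common-ends⇒≡ {u} {v} {e} {f} u≢v u∈e v∈e u∈f v∈f = noMulti G e f (same-ends u∈e v∈e u∈f v∈f)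
    where
    same-ends : u ∈ₑ e → v ∈ₑ e → u ∈ₑ f → v ∈ₑ f → ends G e ≡ ends G f ⊎ (end₁ e ≡ end₂ f × end₂ e ≡ end₁ f)
    same-ends (inj₁ e₁≡u) (inj₁ e₁≡v) _ _ = contradiction (trans (sym e₁≡u) e₁≡v) u≢v
    same-ends (inj₂ e₂≡u) (inj₂ e₂≡v) _ _ = contradiction (trans (sym e₂≡u) e₂≡v) u≢v
    same-ends _ _ (inj₁ f₁≡u) (inj₁ f₁≡v) = contradiction (trans (sym f₁≡u) f₁≡v) u≢v
    same-ends _ _ (inj₂ f₂≡u) (inj₂ f₂≡v) = contradiction (trans (sym f₂≡u) f₂≡v) u≢v
    same-ends (inj₁ e₁≡u) (inj₂ e₂≡v) (inj₁ f₁≡u) (inj₂ f₂≡v) =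
      inj₁ (×-≡,≡→≡ (trans e₁≡u (sym f₁≡u) , trans e₂≡v (sym f₂≡v)))
    same-ends (inj₁ e₁≡u) (inj₂ e₂≡v) (inj₂ f₂≡u) (inj₁ f₁≡v) =
      inj₂ (trans e₁≡u (sym f₂≡u) , trans e₂≡v (sym f₁≡v))
    same-ends (inj₂ e₂≡u) (inj₁ e₁≡v) (inj₁ f₁≡u) (inj₂ f₂≡v) =
      inj₂ (trans e₁≡v (sym f₂≡v) , trans e₂≡u (sym f₁≡u))
    same-ends (inj₂ e₂≡u) (inj₁ e₁≡v) (inj₂ f₂≡u) (inj₁ f₁≡v) =
      inj₁ (×-≡,≡→≡ (trans e₁≡v (sym f₁≡v) , trans e₂≡u (sym f₂≡u)))

  Star : Vertex G → EdgeSet G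
  Star v = tabulate (incident G v)

  ∈ₑ⇒∈Star : ∀ {v e} → v ∈ₑ e → e ∈ Star v
  ∈ₑ⇒∈Star {v} {e} v∈ₑe = lookup⇒[]= e (Star v) (trans (lookup∘tabulate (incident G v) e) (∈ₑ⇒incident v∈ₑe))

  ∈Star⇒∈ₑ : ∀ {v e} → e ∈ Star v → v ∈ₑ e
  ∈Star⇒∈ₑ {v} {e} e∈Star = incident⇒∈ₑ (trans (sym (lookup∘tabulate (incident G v) e)) ([]=⇒lookup e∈Star))

  three-edges⇒2<degree : ∀ {v e₁ e₂ e₃} → v ∈ₑ e₁ → v ∈ₑ e₂ → v ∈ₑ e₃ →
    e₁ ≢ e₂ → e₁ ≢ e₃ → e₂ ≢ e₃ → 2 < degree G v
  three-edges⇒2<degree v∈e₁ v∈e₂ v∈e₃ = distinct⇒2<∣p∣ (∈ₑ⇒∈Star v∈e₁) (∈ₑ⇒∈Star v∈e₂) (∈ₑ⇒∈Star v∈e₃)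

  2<degree⇒third-edge : ∀ {v} → 2 < degree G v → ∀ e₁ e₂ → ∃ λ e₃ → v ∈ₑ e₃ × e₃ ≢ e₁ × e₃ ≢ e₂
  2<degree⇒third-edge {v} 2<deg e₁ e₂ with nonempty? (Star v - e₁ - e₂)
  ... | yes (e₃ , e₃∈) = e₃ , ∈Star⇒∈ₑ (p─q⊆p _ _ (p─q⊆p _ _ e₃∈)) ,
                         x∈p-y⇒x≢y (Star v) (p─q⊆p _ _ e₃∈) , x∈p-y⇒x≢y (Star v - e₁) e₃∈
  ... | no ¬nonempty = contradiction (begin
    degree G v                   ≤⟨ ∣p∣≤1+∣p-x∣ (Star v) e₁ ⟩
    suc ∣ Star v - e₁ ∣          ≤⟨ s≤s (∣p∣≤1+∣p-x∣ (Star v - e₁) e₂) ⟩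
    2 + ∣ Star v - e₁ - e₂ ∣     ≡⟨ cong (2 +_) (trans (cong ∣_∣ (Empty-unique ¬nonempty)) (∣⊥∣≡0 (m G))) ⟩
    2                            ∎) (<⇒≱ 2<deg)
    where open ≤-Reasoning

  degree≤2⇒two-edges : ∀ {v e₁ e₂ g} → degree G v ≤ 2 → v ∈ₑ e₁ → v ∈ₑ e₂ → e₁ ≢ e₂ → v ∈ₑ g →
    g ≡ e₁ ⊎ g ≡ e₂
  degree≤2⇒two-edges {e₁ = e₁} {e₂} {g} deg≤2 v∈e₁ v∈e₂ e₁≢e₂ v∈g with g ≟ᶠ e₁ | g ≟ᶠ e₂
  ... | yes g≡e₁ | _ = inj₁ g≡e₁
  ... | no _ | yes g≡e₂ = inj₂ g≡e₂
  ... | no g≢e₁ | no g≢e₂ =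
    contradiction (three-edges⇒2<degree v∈e₁ v∈e₂ v∈g e₁≢e₂ (g≢e₁ ∘ sym) (g≢e₂ ∘ sym)) (≤⇒≯ deg≤2)

  Adjacent? : ∀ u v → Dec (Adjacent G u v)
  Adjacent? u v = any? λ e → (≡-dec _≟ᶠ_ _≟ᶠ_ (ends G e) (u , v)) ⊎-dec (≡-dec _≟ᶠ_ _≟ᶠ_ (ends G e) (v , u))

-- Necessity

suc-% : ∀ k n .{{_ : NonZero n}} → suc k % n ≡ suc (k % n) % n
suc-% k n = trans (cong (λ x → suc x % n) (m≡m%n+[m/n]*n k n)) ([m+kn]%n≡m%n (suc (k % n)) (k / n) n)

%-shift-≢ : ∀ a d n .{{_ : NonZero n}} → 0 < d → d < n → a % n ≢ (d + a) % n
%-shift-≢ a d n 0<d d<n a%n≡[d+a]%n = multiple ((d + r) / n) d≡q*n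
  where
  r = a % n
  r≡[d+r]%n : r ≡ (d + r) % n
  r≡[d+r]%n = trans a%n≡[d+a]%n (trans (%-distribˡ-+ d a n) (cong (λ x → (x + r) % n) (m<n⇒m%n≡m d<n)))
  d≡q*n : d ≡ ((d + r) / n) * n
  d≡q*n = +-cancelˡ-≡ r _ _ (trans (+-comm r d)
            (trans (m≡m%n+[m/n]*n (d + r) n) (cong (_+ ((d + r) / n) * n) (sym r≡[d+r]%n))))
  multiple : ∀ q → d ≡ q * n → ⊥
  multiple zero d≡0 = <-irrefl (sym d≡0) 0<d
  multiple (suc q) d≡n+q*n = <⇒≱ d<n (subst (n ≤_) (sym d≡n+q*n) (m≤m+n n (q * n)))

odd⇒even-pred : ∀ q → suc q % 2 ≡ 1 → q ≡ (suc q / 2) * 2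
odd⇒even-pred q odd = suc-injective (trans (m≡m%n+[m/n]*n (suc q) 2) (cong (_+ (suc q / 2) * 2) odd))

data LastView : ∀ {p} → Fin (suc p) → Set where
  last  : ∀ {p} → LastView (fromℕ p)
  inner : ∀ {p} (j : Fin p) → LastView (inject₁ j)

lastView : ∀ {p} (i : Fin (suc p)) → LastView i
lastView {zero} zero = last
lastView {suc p} zero = inner zero
lastView {suc p} (suc i) with lastView i
... | last = last
... | inner j = inner (suc j)

module Necessity (G : Graph) {M₁ M₂ : Family (m G)} (isM₁ : IsMatroid M₁) (isM₂ : IsMatroid M₂)
  (matchings : ∀ A → (IsMatching G A → M₁ A × M₂ A) × (M₁ A × M₂ A → IsMatching G A)) where

  open Incidence G

  Disjoint : EdgeIx G → EdgeIx G → Set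
  Disjoint e f = ∀ {v} → v ∈ₑ e → v ∈ₑ f → ⊥

  disjoint⇒≢ : ∀ {e f v} → Disjoint e f → v ∈ₑ e → e ≢ f
  disjoint⇒≢ e#f v∈e refl = e#f v∈e v∈e

  singleton : ∀ e → M₁ ⁅ e ⁆ × M₂ ⁅ e ⁆
  singleton e = proj₁ (matchings ⁅ e ⁆) λ f g f∈ g∈ f≢g _ _ →
    f≢g (trans (x∈⁅y⁆⇒x≡y e f∈) (sym (x∈⁅y⁆⇒x≡y e g∈)))

  open CommonIndependent isM₁ isM₂ singleton

  disjoint-independent : ∀ {e f} → Disjoint e f → M₁ (pair e f) × M₂ (pair e f)
  disjoint-independent {e} {f} e#f = proj₁ (matchings (pair e f)) matching
    where
    matching : IsMatching G (pair e f)
    matching a b a∈ b∈ a≢b v (v∈a , v∈b) with ∈pair⁻ a∈ | ∈pair⁻ b∈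
    ... | inj₁ refl | inj₁ refl = a≢b refl
    ... | inj₁ refl | inj₂ refl = e#f (incident⇒∈ₑ v∈a) (incident⇒∈ₑ v∈b)
    ... | inj₂ refl | inj₁ refl = e#f (incident⇒∈ₑ v∈b) (incident⇒∈ₑ v∈a)
    ... | inj₂ refl | inj₂ refl = a≢b refl

  sharing⇒conflict : ∀ {e f v} → e ≢ f → v ∈ₑ e → v ∈ₑ f → Conflict e f
  sharing⇒conflict {e} {f} {v} e≢f v∈e v∈f common =
    proj₂ (matchings (pair e f)) common e f (∈pairˡ e f) (∈pairʳ e f) e≢f v (∈ₑ⇒incident v∈e , ∈ₑ⇒incident v∈f)

  ¬heavy-triangle-edge : ∀ {u w z} → Adjacent G u w → Adjacent G w z → Adjacent G z u →
    2 < degree G u → 2 < degree G w → ⊥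
  ¬heavy-triangle-edge {u} {w} {z} (uw , uw-ends) (wz , wz-ends) (zu , zu-ends) 2<deg-u 2<deg-w
    with joins⇒∈ₑ uw uw-ends | joins⇒∈ₑ wz wz-ends | joins⇒∈ₑ zu zu-ends
       | 2<degree⇒third-edge 2<deg-u uw zu | 2<degree⇒third-edge 2<deg-w uw wz
  ... | u∈uw , w∈uw | w∈wz , z∈wz | z∈zu , u∈zu | pu , u∈pu , pu≢uw , pu≢zu | pw , w∈pw , pw≢uw , pw≢wz =
    five-edge-obstruction {uw} {wz} {zu} {pu} {pw}
      (sharing⇒conflict (third-end⇒≢ u≢w u∈uw w∈uw z∈wz z≢u z≢w) w∈uw w∈wz)
      (sharing⇒conflict (third-end⇒≢ u≢w u∈uw w∈uw z∈zu z≢u z≢w) u∈uw u∈zu)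
      (sharing⇒conflict (pu≢uw ∘ sym) u∈uw u∈pu)
      (sharing⇒conflict (pw≢uw ∘ sym) w∈uw w∈pw)
      (sharing⇒conflict (third-end⇒≢ w≢z w∈wz z∈wz u∈zu u≢w (z≢u ∘ sym)) z∈wz z∈zu)
      (sharing⇒conflict (pu≢zu ∘ sym) u∈zu u∈pu)
      (sharing⇒conflict pw≢wz w∈pw w∈wz)
      (disjoint⇒≢ wz#pu w∈wz) (proj₁ (disjoint-independent wz#pu)) (proj₂ (disjoint-independent wz#pu))
      (disjoint⇒≢ zu#pw z∈zu) (proj₁ (disjoint-independent zu#pw)) (proj₂ (disjoint-independent zu#pw))
    where
    u≢w = Adjacent⇒≢ (uw , uw-ends)
    w≢z = Adjacent⇒≢ (wz , wz-ends)
    z≢u = Adjacent⇒≢ (zu , zu-ends)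
    z≢w = w≢z ∘ sym
    wz#pu : Disjoint wz pu
    wz#pu v∈wz v∈pu with only-two-ends w≢z w∈wz z∈wz v∈wz
    ... | inj₁ refl = pu≢uw (common-ends⇒≡ (u≢w ∘ sym) v∈pu u∈pu w∈uw u∈uw)
    ... | inj₂ refl = pu≢zu (common-ends⇒≡ z≢u v∈pu u∈pu z∈zu u∈zu)
    zu#pw : Disjoint zu pw
    zu#pw v∈zu v∈pw with only-two-ends z≢u z∈zu u∈zu v∈zu
    ... | inj₁ refl = pw≢wz (common-ends⇒≡ (w≢z ∘ sym) v∈pw w∈pw z∈wz w∈wz)
    ... | inj₂ refl = pw≢uw (common-ends⇒≡ u≢w v∈pw w∈pw u∈uw w∈uw)

  triangleCondition : TriangleCondition G
  triangleCondition record { p = .2 ; len≡ = refl ; vtx = t ; step = step ; close = close } = heavy-pair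
    where
    t₀₁ = step zero
    t₁₂ = step (suc zero)
    t₂₀ = close
    heavy-pair : ∀ i j → 2 < degree G (t i) → 2 < degree G (t j) → i ≡ j
    heavy-pair zero zero _ _ = refl
    heavy-pair (suc zero) (suc zero) _ _ = refl
    heavy-pair (suc (suc zero)) (suc (suc zero)) _ _ = refl
    heavy-pair zero (suc zero) hi hj = ⊥-elim (¬heavy-triangle-edge t₀₁ t₁₂ t₂₀ hi hj)
    heavy-pair (suc zero) (suc (suc zero)) hi hj = ⊥-elim (¬heavy-triangle-edge t₁₂ t₂₀ t₀₁ hi hj)
    heavy-pair (suc (suc zero)) zero hi hj = ⊥-elim (¬heavy-triangle-edge t₂₀ t₀₁ t₁₂ hi hj)
    heavy-pair (suc zero) zero hi hj =
      ⊥-elim (¬heavy-triangle-edge (Adjacent-sym t₀₁) (Adjacent-sym t₂₀) (Adjacent-sym t₁₂) hi hj)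
    heavy-pair (suc (suc zero)) (suc zero) hi hj =
      ⊥-elim (¬heavy-triangle-edge (Adjacent-sym t₁₂) (Adjacent-sym t₀₁) (Adjacent-sym t₂₀) hi hj)
    heavy-pair zero (suc (suc zero)) hi hj =
      ⊥-elim (¬heavy-triangle-edge (Adjacent-sym t₂₀) (Adjacent-sym t₁₂) (Adjacent-sym t₀₁) hi hj)

  module LongCycle {len} (c : Cycle G len) (3<len : 3 < len) where

    private
      L : ℕ
      L = suc (p c)

    next : Fin L → Fin L
    next i with lastView i
    ... | last = zero
    ... | inner j = suc j

    adjacent-next : ∀ i → Adjacent G (vtx c i) (vtx c (next i))
    adjacent-next i with lastView i
    ... | last = close c
    ... | inner j = step c j

    toℕ-next : ∀ i → toℕ (next i) ≡ suc (toℕ i) % L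
    toℕ-next i with lastView i
    ... | last = sym (trans (cong (λ x → suc x % L) (toℕ-fromℕ (p c))) (n%n≡0 L))
    ... | inner j = sym (trans (cong (λ x → suc x % L) (toℕ-inject₁ j)) (m<n⇒m%n≡m (s≤s (toℕ<n j))))

    position : ℕ → Fin L
    position k = k mod L

    toℕ-position : ∀ k → toℕ (position k) ≡ k % L
    toℕ-position k = toℕ-fromℕ< (m%n<n k L)

    position-suc : ∀ k → position (suc k) ≡ next (position k)
    position-suc k = toℕ-injective (begin
      toℕ (position (suc k))          ≡⟨ toℕ-position (suc k) ⟩
      suc k % L                       ≡⟨ suc-% k L ⟩
      suc (k % L) % L                 ≡⟨ cong (λ x → suc x % L) (sym (toℕ-position k)) ⟩
      suc (toℕ (position k)) % L      ≡⟨ sym (toℕ-next (position k)) ⟩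
      toℕ (next (position k))         ∎)
      where open ≡-Reasoning

    W : ℕ → Vertex G
    W k = vtx c (position k)

    E : ℕ → EdgeIx G
    E k = proj₁ (adjacent-next (position k))

    E-period : ∀ k → E (k + L) ≡ E k
    E-period k = cong (proj₁ ∘ adjacent-next)
      (toℕ-injective (trans (toℕ-position (k + L)) (trans ([m+n]%n≡m%n k L) (sym (toℕ-position k)))))

    ends-E : ∀ k → W k ∈ₑ E k × W (suc k) ∈ₑ E k
    ends-E k with joins⇒∈ₑ (E k) (proj₂ (adjacent-next (position k)))
    ... | W-k∈ , next∈ = W-k∈ , subst (λ i → vtx c i ∈ₑ E k) (sym (position-suc k)) next∈

    W-distinct : ∀ a d → d < 3 → W a ≢ W (suc d + a)
    W-distinct a d d<3 W-a≡W-a+d = %-shift-≢ a (suc d) L (s≤s z≤n) (≤-trans (s≤s d<3) 3<L) (begin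
      a % L                        ≡⟨ sym (toℕ-position a) ⟩
      toℕ (position a)             ≡⟨ cong toℕ (inj c {position a} {position (suc d + a)} W-a≡W-a+d) ⟩
      toℕ (position (suc d + a))   ≡⟨ toℕ-position (suc d + a) ⟩
      (suc d + a) % L              ∎)
      where
      open ≡-Reasoning
      3<L : 3 < L
      3<L = subst (3 <_) (len≡ c) 3<len

    consecutive-conflict : ∀ k → Conflict (E k) (E (suc k))
    consecutive-conflict k = sharing⇒conflict
      (third-end⇒≢ (W-distinct k 0 (s≤s z≤n)) (proj₁ (ends-E k)) (proj₂ (ends-E k)) (proj₂ (ends-E (suc k)))
        (W-distinct k 1 (s≤s (s≤s z≤n)) ∘ sym) (W-distinct (suc k) 0 (s≤s z≤n) ∘ sym))
      (proj₂ (ends-E k)) (proj₁ (ends-E (suc k)))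

    skip-disjoint : ∀ k → Disjoint (E k) (E (2 + k))
    skip-disjoint k v∈ v∈′
      with only-two-ends (W-distinct k 0 (s≤s z≤n)) (proj₁ (ends-E k)) (proj₂ (ends-E k)) v∈
         | only-two-ends (W-distinct (2 + k) 0 (s≤s z≤n)) (proj₁ (ends-E (2 + k))) (proj₂ (ends-E (2 + k))) v∈′
    ... | inj₁ refl | inj₁ eq = W-distinct k 1 (s≤s (s≤s z≤n)) eq
    ... | inj₁ refl | inj₂ eq = W-distinct k 2 (s≤s (s≤s (s≤s z≤n))) eq
    ... | inj₂ refl | inj₁ eq = W-distinct (suc k) 0 (s≤s z≤n) eq
    ... | inj₂ refl | inj₂ eq = W-distinct (suc k) 1 (s≤s (s≤s z≤n)) eq

    no-gap : ∀ {M} → IsMatroid M → (∀ e → M ⁅ e ⁆) → (∀ k → M (pair (E k) (E (2 + k)))) →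
      ∀ k → ¬ M (pair (E k) (E (suc k))) → ¬ M (pair (E (suc k)) (E (2 + k))) → ⊥
    no-gap isM independent-singleton independent-skip k =
      pair-augment isM {E (suc k)} {E k} {E (2 + k)} (disjoint⇒≢ (skip-disjoint k) (proj₁ (ends-E k)))
        (independent-singleton (E (suc k))) (independent-skip k) ∘ ¬pair-sym isM {E k} {E (suc k)}

    ¬odd : ∀ j → p c ≡ j * 2 → ⊥
    ¬odd j p≡j*2 = no-odd-alternation A B consecutive-conflict
      (no-gap isM₁ (proj₁ ∘ singleton) (proj₁ ∘ disjoint-independent ∘ skip-disjoint))
      (no-gap isM₂ (proj₂ ∘ singleton) (proj₂ ∘ disjoint-independent ∘ skip-disjoint))
      j (subst (λ n → A (suc n) ⇔ A 0) p≡j*2 period)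
      where
      M₁-pair : EdgeIx G → EdgeIx G → Set
      M₁-pair a b = M₁ (pair a b)
      A B : ℕ → Set
      A k = M₁ (pair (E k) (E (suc k)))
      B k = M₂ (pair (E k) (E (suc k)))
      period : A L ⇔ A 0
      period = mk⇔ (subst₂ M₁-pair (E-period 0) (E-period 1))
                   (subst₂ M₁-pair (sym (E-period 0)) (sym (E-period 1)))

  noLongOddCycle : NoLongOddCycle G
  noLongOddCycle len 5≤len odd c = LongCycle.¬odd c (≤-trans (s≤s (s≤s (s≤s (s≤s z≤n)))) 5≤len)
    (suc (p c) / 2) (odd⇒even-pred (p c) (subst (λ n → n % 2 ≡ 1) (len≡ c) odd))

-- Sufficiency

module SpecialEdges (G : Graph) where

  open Incidence G

  Apex : Vertex G → Vertex G → Vertex G → Set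
  Apex a u w = 2 < degree G a ⊎ (a <ᶠ u × a <ᶠ w)

  SpecialPair : Vertex G → Vertex G → Set
  SpecialPair u w = degree G u ≤ 2 × degree G w ≤ 2 × ∃ λ a → Adjacent G a u × Adjacent G a w × Apex a u w

  SpecialPair-sym : ∀ {u w} → SpecialPair u w → SpecialPair w u
  SpecialPair-sym (du , dw , a , au , aw , inj₁ heavy) = dw , du , a , aw , au , inj₁ heavy
  SpecialPair-sym (du , dw , a , au , aw , inj₂ (a<u , a<w)) = dw , du , a , aw , au , inj₂ (a<w , a<u)

  Special : EdgeIx G → Set
  Special e = SpecialPair (end₁ e) (end₂ e)

  special? : ∀ e → Dec (Special e)
  special? e = (degree G (end₁ e) ≤? 2) ×-dec (degree G (end₂ e) ≤? 2) ×-dec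
    any? λ a → Adjacent? a (end₁ e) ×-dec Adjacent? a (end₂ e) ×-dec
               ((2 <? degree G a) ⊎-dec ((a <?ᶠ end₁ e) ×-dec (a <?ᶠ end₂ e)))

  joins⇒special : ∀ {e u w} → ends G e ≡ (u , w) ⊎ ends G e ≡ (w , u) → SpecialPair u w → Special e
  joins⇒special (inj₁ e≡uw) uw rewrite e≡uw = uw
  joins⇒special (inj₂ e≡wu) uw rewrite e≡wu = SpecialPair-sym uw

  special-other-end : ∀ {t v} → Special t → v ∈ₑ t → ∃ λ c → c ≢ v × c ∈ₑ t × SpecialPair v c
  special-other-end {t} st (inj₁ refl) = end₂ t , noLoop G t ∘ sym , inj₂ refl , st
  special-other-end {t} st (inj₂ refl) = end₁ t , noLoop G t , inj₁ refl , SpecialPair-sym st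

  private
    apex∉ : ∀ {t v c a} → c ≢ v → v ∈ₑ t → c ∈ₑ t → Adjacent G a v → Adjacent G a c → ¬ a ∈ₑ t
    apex∉ c≢v v∈t c∈t av ac a∈t with only-two-ends (c≢v ∘ sym) v∈t c∈t a∈t
    ... | inj₁ a≡v = Adjacent⇒≢ av a≡v
    ... | inj₂ a≡c = Adjacent⇒≢ ac a≡c

    apex-edge : ∀ {t v c a} → c ≢ v → v ∈ₑ t → c ∈ₑ t → Adjacent G a v → Adjacent G a c →
      ∃ λ g → a ∈ₑ g × v ∈ₑ g × g ≢ t
    apex-edge c≢v v∈t c∈t (g , g-av) ac with joins⇒∈ₑ g g-av
    ... | a∈g , v∈g = g , a∈g , v∈g , λ { refl → apex∉ c≢v v∈t c∈t (g , g-av) ac a∈g }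

    apex-is-other-end : ∀ {t t′ v c c′ a} → t ≢ t′ → degree G v ≤ 2 → c ≢ v → v ∈ₑ t → c ∈ₑ t →
      c′ ≢ v → v ∈ₑ t′ → c′ ∈ₑ t′ → Adjacent G a v → Adjacent G a c → a ≡ c′
    apex-is-other-end t≢t′ dv c≢v v∈t c∈t c′≢v v∈t′ c′∈t′ av ac
      with apex-edge c≢v v∈t c∈t av ac
    ... | g , a∈g , v∈g , g≢t with degree≤2⇒two-edges dv v∈t v∈t′ t≢t′ v∈g
    ... | inj₁ g≡t = contradiction g≡t g≢t
    ... | inj₂ refl with only-two-ends (c′≢v ∘ sym) v∈t′ c′∈t′ a∈g
    ... | inj₁ a≡v = contradiction a≡v (Adjacent⇒≢ av)
    ... | inj₂ a≡c′ = a≡c′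

  special-unique : ∀ {t t′ v} → Special t → Special t′ → v ∈ₑ t → v ∈ₑ t′ → t ≡ t′
  special-unique {t} {t′} {v} st st′ v∈t v∈t′ with t ≟ᶠ t′
  ... | yes t≡t′ = t≡t′
  ... | no t≢t′
    with special-other-end st v∈t | special-other-end st′ v∈t′
  ... | c , c≢v , c∈t , (dv , dc , a , av , ac , apex) | c′ , c′≢v , c′∈t′ , (_ , dc′ , a′ , a′v , a′c′ , apex′)
    with apex-is-other-end t≢t′ dv c≢v v∈t c∈t c′≢v v∈t′ c′∈t′ av ac
       | apex-is-other-end (t≢t′ ∘ sym) dv c′≢v v∈t′ c′∈t′ c≢v v∈t c∈t a′v a′c′
  ... | refl | refl with apex | apex′
  ... | inj₁ heavy | _ = contradiction heavy (≤⇒≯ dc′)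
  ... | inj₂ _ | inj₁ heavy′ = contradiction heavy′ (≤⇒≯ dc)
  ... | inj₂ (_ , c′<c) | inj₂ (_ , c<c′) = ⊥-elim (<-asymᶠ c′<c c<c′)

  ProperColouring : (Vertex G → Bool) → Set
  ProperColouring col = ∀ e → ¬ Special e → col (end₁ e) ≢ col (end₂ e)

  properColouring? : ∀ col → Dec (ProperColouring col)
  properColouring? col = all? λ e → ¬? (special? e) →-dec ¬? (col (end₁ e) ≟ᵇ col (end₂ e))

  ProperColouring-resp : ∀ {col col′} → (∀ v → col v ≡ col′ v) → ProperColouring col → ProperColouring col′
  ProperColouring-resp col≗col′ proper e ¬se eq =
    proper e ¬se (trans (col≗col′ _) (trans eq (sym (col≗col′ _))))

  Meet : EdgeIx G → EdgeIx G → Set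
  Meet e f = ∃ λ w → w ∈ₑ e × w ∈ₑ f

  special-ends-meet : ∀ {t x y e f} → Special t → x ≢ y → x ∈ₑ t → y ∈ₑ t → x ∈ₑ e → y ∈ₑ f → Meet e f
  special-ends-meet {x = x} {y} st x≢y x∈t y∈t x∈e y∈f with special-other-end st x∈t
  ... | c , c≢x , c∈t , (dx , dc , a , ax , ac , _) with only-two-ends x≢y x∈t y∈t c∈t
  ... | inj₁ c≡x = contradiction c≡x c≢x
  ... | inj₂ refl with apex-edge c≢x x∈t c∈t ax ac | apex-edge (c≢x ∘ sym) c∈t x∈t ac ax
  ... | gx , a∈gx , x∈gx , gx≢t | gy , a∈gy , y∈gy , gy≢t
    with degree≤2⇒two-edges dx x∈t x∈gx (gx≢t ∘ sym) x∈e | degree≤2⇒two-edges dc y∈t y∈gy (gy≢t ∘ sym) y∈f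
  ... | inj₁ refl | _ = y , y∈t , y∈f
  ... | inj₂ _ | inj₁ refl = x , x∈e , x∈t
  ... | inj₂ refl | inj₂ refl = a , a∈gx , a∈gy

module PartitionByColouring (G : Graph) (col : Vertex G → Bool) (proper : SpecialEdges.ProperColouring G col)
  where

  open Incidence G
  open SpecialEdges G

  proper-at : ∀ {g u w} → ¬ Special g → u ∈ₑ g → w ∈ₑ g → u ≢ w → col u ≢ col w
  proper-at {g} ¬sg (inj₁ refl) (inj₂ refl) _ = proper g ¬sg
  proper-at {g} ¬sg (inj₂ refl) (inj₁ refl) _ = proper g ¬sg ∘ sym
  proper-at _ (inj₁ refl) (inj₁ refl) u≢w = contradiction refl u≢w
  proper-at _ (inj₂ refl) (inj₂ refl) u≢w = contradiction refl u≢w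

  Anchor : Set
  Anchor = Vertex G ⊎ EdgeIx G

  anchor : Vertex G → Anchor
  anchor v with any? (λ t → special? t ×-dec (v ∈ₑ? t))
  ... | yes (t , _) = inj₂ t
  ... | no _ = inj₁ v

  anchor-special : ∀ {t v} → Special t → v ∈ₑ t → anchor v ≡ inj₂ t
  anchor-special {t} {v} st v∈t with any? (λ t → special? t ×-dec (v ∈ₑ? t))
  ... | yes (t′ , st′ , v∈t′) = cong inj₂ (special-unique st′ st v∈t′ v∈t)
  ... | no ¬special = contradiction (t , st , v∈t) ¬special

  anchor≡inj₂⁻ : ∀ {v t} → anchor v ≡ inj₂ t → Special t × v ∈ₑ t
  anchor≡inj₂⁻ {v} eq with any? (λ t → special? t ×-dec (v ∈ₑ? t))
  anchor≡inj₂⁻ refl | yes (_ , special-at-v) = special-at-v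

  anchor≡inj₁⁻ : ∀ {v u} → anchor v ≡ inj₁ u → v ≡ u
  anchor≡inj₁⁻ {v} eq with any? (λ t → special? t ×-dec (v ∈ₑ? t))
  anchor≡inj₁⁻ refl | no _ = refl

  same-anchor⇒meet : ∀ {x y e f} → x ∈ₑ e → y ∈ₑ f → anchor x ≡ anchor y → Meet e f
  same-anchor⇒meet {x} {y} x∈e y∈f eq with anchor x in anchor-x
  ... | inj₁ u with anchor≡inj₁⁻ anchor-x | anchor≡inj₁⁻ (sym eq)
  ... | refl | refl = x , x∈e , y∈f
  same-anchor⇒meet {x} {y} x∈e y∈f eq | inj₂ t with anchor≡inj₂⁻ anchor-x | anchor≡inj₂⁻ (sym eq) | x ≟ᶠ y
  ... | st , x∈t | _ , y∈t | no x≢y = special-ends-meet st x≢y x∈t y∈t x∈e y∈f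
  ... | _ | _ | yes refl = x , x∈e , y∈f

  block : Bool → EdgeIx G → Anchor
  block s e with col (end₁ e) ≟ᵇ s
  ... | yes _ = anchor (end₁ e)
  ... | no _ with col (end₂ e) ≟ᵇ s
  ... | yes _ = anchor (end₂ e)
  ... | no _ = inj₂ e

  block-view : ∀ s e → (∃ λ x → x ∈ₑ e × col x ≡ s × block s e ≡ anchor x)
                     ⊎ ((∀ {x} → x ∈ₑ e → col x ≢ s) × block s e ≡ inj₂ e)
  block-view s e with col (end₁ e) ≟ᵇ s
  ... | yes c₁≡s = inj₁ (end₁ e , inj₁ refl , c₁≡s , refl)
  ... | no c₁≢s with col (end₂ e) ≟ᵇ s
  ... | yes c₂≡s = inj₁ (end₂ e , inj₂ refl , c₂≡s , refl)
  ... | no c₂≢s = inj₂ ((λ { (inj₁ refl) → c₁≢s ; (inj₂ refl) → c₂≢s }) , refl)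

  block-at-colour : ∀ {v e} → v ∈ₑ e → block (col v) e ≡ anchor v
  block-at-colour {v} {e} v∈e with block-view (col v) e
  ... | inj₂ (no-end , _) = contradiction refl (no-end v∈e)
  ... | inj₁ (x , x∈e , cx≡cv , eq) with x ≟ᶠ v | special? e
  ... | yes refl | _ = eq
  ... | no x≢v | yes se = trans eq (trans (anchor-special se x∈e) (sym (anchor-special se v∈e)))
  ... | no x≢v | no ¬se = contradiction cx≡cv (proper-at ¬se x∈e v∈e x≢v)

  same-block⇒meet : ∀ s {e f} → e ≢ f → block s e ≡ block s f → Meet e f
  same-block⇒meet s {e} {f} e≢f eq with block-view s e | block-view s f
  ... | inj₁ (x , x∈e , _ , ex) | inj₁ (y , y∈f , _ , fy) =
    same-anchor⇒meet x∈e y∈f (trans (sym ex) (trans eq fy))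
  ... | inj₁ (x , _ , cx≡s , ex) | inj₂ (no-end , fe) =
    contradiction cx≡s (no-end (proj₂ (anchor≡inj₂⁻ (trans (sym ex) (trans eq fe)))))
  ... | inj₂ (no-end , ee) | inj₁ (y , _ , cy≡s , fy) =
    contradiction cy≡s (no-end (proj₂ (anchor≡inj₂⁻ (trans (sym fy) (trans (sym eq) ee)))))
  ... | inj₂ (_ , ee) | inj₂ (_ , fe) = contradiction (inj₂-injective (trans (sym ee) (trans eq fe))) e≢f

  matching⇒independent : ∀ s {A} → IsMatching G A → PartitionMatroid (block s) A
  matching⇒independent s matching {e} {f} e∈A f∈A eq with e ≟ᶠ f
  ... | yes e≡f = e≡f
  ... | no e≢f with same-block⇒meet s e≢f eq
  ... | w , w∈e , w∈f = contradiction (∈ₑ⇒incident w∈e , ∈ₑ⇒incident w∈f) (matching e f e∈A f∈A e≢f w)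

  independent⇒matching : ∀ {A} → (∀ s → PartitionMatroid (block s) A) → IsMatching G A
  independent⇒matching independent e f e∈A f∈A e≢f v (v∈e , v∈f) =
    e≢f (independent (col v) e∈A f∈A
      (trans (block-at-colour (incident⇒∈ₑ v∈e)) (sym (block-at-colour (incident⇒∈ₑ v∈f)))))

  matchings-intersection : MatchingsIntersectionOfTwoMatroids G
  matchings-intersection =
    PartitionMatroid (block false) , PartitionMatroid (block true) ,
    partitionMatroid-isMatroid _≟ᵃ_ (block false) , partitionMatroid-isMatroid _≟ᵃ_ (block true) ,
    λ A → (λ matching → matching⇒independent false matching , matching⇒independent true matching) ,
          (λ (i₀ , i₁) → independent⇒matching λ { false → i₀ ; true → i₁ })
    where
    _≟ᵃ_ : DecidableEquality Anchor
    _≟ᵃ_ = ≡-decˢ _≟ᶠ_ _≟ᶠ_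

least : ∀ {k} {P : Fin k → Set} → (∀ i → Dec (P i)) → ∃ P → ∃ λ r → P r × (∀ {j} → P j → r ≤ᶠ j)
least {suc k} {P} P? (i , pi) with P? zero
... | yes p₀ = zero , p₀ , λ _ → z≤n
... | no ¬p₀ with i
... | zero = contradiction pi ¬p₀
... | suc i′ with least (P? ∘ suc) (i′ , pi)
... | r , pr , minimal = suc r , pr , λ { {zero} p₀ → contradiction p₀ ¬p₀ ; {suc j} pj → s≤s (minimal pj) }

¬¬-finite-choice : ∀ {k} {Q : Fin k → Set} → (∀ i → ¬ ¬ Q i) → ¬ ¬ (∀ i → Q i)
¬¬-finite-choice {zero} _ no-choice = no-choice λ ()
¬¬-finite-choice {suc k} ¬¬q no-choice = ¬¬q zero λ q₀ →
  ¬¬-finite-choice (¬¬q ∘ suc) λ qs → no-choice λ { zero → q₀ ; (suc i) → qs i }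

least-of-three : ∀ {n} {x y z : Fin n} → x ≢ y → y ≢ z → z ≢ x →
  (x <ᶠ y × x <ᶠ z) ⊎ (y <ᶠ z × y <ᶠ x) ⊎ (z <ᶠ x × z <ᶠ y)
least-of-three {x = x} {y} {z} x≢y y≢z z≢x with <-cmpᶠ x y
... | tri≈ _ x≡y _ = contradiction x≡y x≢y
... | tri< x<y _ _ with <-cmpᶠ x z
...   | tri< x<z _ _ = inj₁ (x<y , x<z)
...   | tri≈ _ x≡z _ = contradiction (sym x≡z) z≢x
...   | tri> _ _ z<x = inj₂ (inj₂ (z<x , <-transᶠ z<x x<y))
least-of-three {x = x} {y} {z} x≢y y≢z z≢x | tri> _ _ y<x with <-cmpᶠ y z
...   | tri< y<z _ _ = inj₂ (inj₁ (y<z , y<x))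
...   | tri≈ _ y≡z _ = contradiction y≡z y≢z
...   | tri> _ _ z<y = inj₂ (inj₂ (<-transᶠ z<y y<x , z<y))

parity-suc : ∀ n → parity (suc n) ≡ parity n ⁻¹
parity-suc n = trans (sym (⁻¹-involutive (parity (suc n)))) (cong _⁻¹ (suc-homo-⁻¹ n))

odd-sum : ∀ a b → parity (a + b) ≡ 1ℙ → parity a ≡ 1ℙ ⊎ parity b ≡ 1ℙ
odd-sum a b odd with parity a | parity b | trans (sym (+-homo-+ a b)) odd
... | 1ℙ | _ | _ = inj₁ refl
... | 0ℙ | 1ℙ | _ = inj₂ refl

odd⇒%2≡1 : ∀ n → parity n ≡ 1ℙ → n % 2 ≡ 1
odd⇒%2≡1 (suc zero) _ = refl
odd⇒%2≡1 (suc (suc n)) odd = odd⇒%2≡1 n odd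

suc-sum⇒< : ∀ {n a b} → suc n ≡ suc a + suc b → a < n × b < n
suc-sum⇒< {a = a} {b} eq = ≤-pred (subst (suc a <_) (sym eq) (m<m+n (suc a) (s≤s z≤n))) ,
                           ≤-pred (subst (suc b <_) (sym eq) (m<n+m (suc b) (s≤s z≤n)))

length-split : ∀ {A : Set} (as : List A) y bs cs →
  length (as ++ y ∷ bs ++ y ∷ cs) ≡ suc (length bs) + suc (length (cs ++ as))
length-split as y bs cs rewrite length-++ as {y ∷ bs ++ y ∷ cs} | length-++ bs {y ∷ cs} | length-++ cs {as} =
  solve 3 (λ a b c → a :+ (con 1 :+ (b :+ (con 1 :+ c))) := (con 1 :+ b) :+ (con 1 :+ (c :+ a)))
    refl (length as) (length bs) (length cs)

module Chains {V : Set} (R : V → V → Set) where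

  Chain : V → List V → Set
  Chain x [] = ⊤
  Chain x (y ∷ ys) = R x y × Chain y ys

  lastOf : V → List V → V
  lastOf x [] = x
  lastOf x (y ∷ ys) = lastOf y ys

  lastOf-++ : ∀ x ps qs → lastOf x (ps ++ qs) ≡ lastOf (lastOf x ps) qs
  lastOf-++ x [] qs = refl
  lastOf-++ x (p ∷ ps) qs = lastOf-++ p ps qs

  Chain-++⁻ : ∀ x ps qs → Chain x (ps ++ qs) → Chain x ps × Chain (lastOf x ps) qs
  Chain-++⁻ x [] qs chain = tt , chain
  Chain-++⁻ x (p ∷ ps) qs (r , chain) with Chain-++⁻ p ps qs chain
  ... | chain₁ , chain₂ = (r , chain₁) , chain₂

  Chain-++⁺ : ∀ x ps qs → Chain x ps → Chain (lastOf x ps) qs → Chain x (ps ++ qs)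
  Chain-++⁺ x [] qs _ chain = chain
  Chain-++⁺ x (p ∷ ps) qs (r , chain₁) chain₂ = r , Chain-++⁺ p ps qs chain₁ chain₂

  Chain-step : ∀ x xs → Chain x xs → ∀ i → R (lookup (x ∷ xs) (inject₁ i)) (lookup xs i)
  Chain-step x (y ∷ ys) (r , _) zero = r
  Chain-step x (y ∷ ys) (_ , chain) (suc i) = Chain-step y ys chain i

  lookup-last : ∀ x xs → lookup (x ∷ xs) (fromℕ (length xs)) ≡ lastOf x xs
  lookup-last x [] = refl
  lookup-last x (y ∷ ys) = lookup-last y ys

  -- A closed walk x, xs, x of length 1 + length xs.
  Closed : V → List V → Set
  Closed x xs = R (lastOf x xs) x × Chain x xs

  split-closed : ∀ x xs as y bs cs → x ∷ xs ≡ as ++ y ∷ bs ++ y ∷ cs → Closed x xs →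
    Closed y bs × Closed y (cs ++ as)
  split-closed x xs as y bs cs x∷xs≡ (r-last , chain) =
    (r-bs , chain-bs) ,
    subst (λ z → R z y) (sym last-cs++as) r-as ,
    Chain-++⁺ y cs as chain-cs (subst (λ z → Chain z as) ℓ≡ chain-as)
    where
    ℓ = lastOf x xs
    ℓ≡ : ℓ ≡ lastOf y cs
    ℓ≡ = trans (cong (lastOf ℓ) x∷xs≡) (trans (lastOf-++ ℓ as (y ∷ bs ++ y ∷ cs)) (lastOf-++ y bs (y ∷ cs)))
    whole = Chain-++⁻ ℓ as (y ∷ bs ++ y ∷ cs) (subst (Chain ℓ) x∷xs≡ (r-last , chain))
    chain-as = proj₁ whole
    r-as = proj₁ (proj₂ whole)
    rest = Chain-++⁻ y bs (y ∷ cs) (proj₂ (proj₂ whole))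
    chain-bs = proj₁ rest
    r-bs = proj₁ (proj₂ rest)
    chain-cs = proj₂ (proj₂ rest)
    last-cs++as : lastOf y (cs ++ as) ≡ lastOf ℓ as
    last-cs++as = trans (lastOf-++ y cs as) (cong (λ z → lastOf z as) (sym ℓ≡))

  module _ (_≟ᵛ_ : DecidableEquality V) where

    Repetition : List V → Set
    Repetition ws = ∃ λ as → ∃ λ y → ∃ λ bs → ∃ λ cs → ws ≡ as ++ y ∷ bs ++ y ∷ cs

    private
      find : ∀ x xs → (∃ λ bs → ∃ λ cs → xs ≡ bs ++ x ∷ cs) ⊎ (∀ i → lookup xs i ≢ x)
      find x [] = inj₂ λ ()
      find x (y ∷ ys) with y ≟ᵛ x
      ... | yes refl = inj₁ ([] , ys , refl)
      ... | no y≢x with find x ys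
      ... | inj₁ (bs , cs , eq) = inj₁ (y ∷ bs , cs , cong (y ∷_) eq)
      ... | inj₂ ∉ys = inj₂ λ { zero → y≢x ; (suc i) → ∉ys i }

    repetition? : ∀ ws → Repetition ws ⊎ (∀ {i j} → lookup ws i ≡ lookup ws j → i ≡ j)
    repetition? [] = inj₂ λ { {()} }
    repetition? (x ∷ xs) with find x xs
    ... | inj₁ (bs , cs , eq) = inj₁ ([] , x , bs , cs , cong (x ∷_) eq)
    ... | inj₂ x∉xs with repetition? xs
    ... | inj₁ (as , y , bs , cs , eq) = inj₁ (x ∷ as , y , bs , cs , cong (x ∷_) eq)
    ... | inj₂ injective = inj₂ λ
      { {zero} {zero} _ → refl
      ; {zero} {suc j} eq → contradiction (sym eq) (x∉xs j)
      ; {suc i} {zero} eq → contradiction eq (x∉xs i)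
      ; {suc i} {suc j} eq → cong suc (injective eq)
      }

module OddClosedWalks (G : Graph) (noLongOddCycle : NoLongOddCycle G) (triangleCondition : TriangleCondition G)
  where

  open Incidence G
  open SpecialEdges G

  Ordinary : Vertex G → Vertex G → Set
  Ordinary u v = ∃ λ e → ¬ Special e × (ends G e ≡ (u , v) ⊎ ends G e ≡ (v , u))

  Ordinary⇒Adjacent : ∀ {u v} → Ordinary u v → Adjacent G u v
  Ordinary⇒Adjacent (e , _ , e-uv) = e , e-uv

  Ordinary-sym : ∀ {u v} → Ordinary u v → Ordinary v u
  Ordinary-sym (e , ¬se , e-uv) = e , ¬se , swap e-uv

  open Chains Ordinary public

  ¬special-opposite : ∀ {u w a} → Ordinary u w → degree G u ≤ 2 → degree G w ≤ 2 →
    Adjacent G a u → Adjacent G a w → ¬ Apex a u w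
  ¬special-opposite (e , ¬se , e-uw) du dw au aw apex = ¬se (joins⇒special e-uw (du , dw , _ , au , aw , apex))

  closed⇒cycle : ∀ x xs → 3 ≤ suc (length xs) → Closed x xs →
    (∀ {i j} → lookup (x ∷ xs) i ≡ lookup (x ∷ xs) j → i ≡ j) → Cycle G (suc (length xs))
  closed⇒cycle x xs 3≤len (r-last , chain) injective = record
    { p = length xs ; len≡ = refl ; len≥3 = 3≤len ; vtx = lookup (x ∷ xs) ; inj = injective
    ; step = Ordinary⇒Adjacent ∘ Chain-step x xs chain
    ; close = subst (λ v → Adjacent G v x) (sym (lookup-last x xs)) (Ordinary⇒Adjacent r-last) }

  ¬ordinary-triangle : ∀ x y z → Closed x (y ∷ z ∷ []) →
    (∀ {i j} → lookup (x ∷ y ∷ z ∷ []) i ≡ lookup (x ∷ y ∷ z ∷ []) j → i ≡ j) → ⊥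
  ¬ordinary-triangle x y z closed@(zx , xy , yz , _) injective =
    by-degree (degree G x ≤? 2) (degree G y ≤? 2) (degree G z ≤? 2)
    where
    adj : ∀ {u v} → Ordinary u v → Adjacent G u v
    adj = Ordinary⇒Adjacent
    adj-sym : ∀ {u v} → Ordinary u v → Adjacent G v u
    adj-sym = Adjacent-sym ∘ Ordinary⇒Adjacent
    two-heavy : ∀ i j → i ≢ j → ¬ degree G (lookup (x ∷ y ∷ z ∷ []) i) ≤ 2 →
      ¬ degree G (lookup (x ∷ y ∷ z ∷ []) j) ≤ 2 → ⊥
    two-heavy i j i≢j hi hj = i≢j (triangleCondition (closed⇒cycle x (y ∷ z ∷ []) ≤-refl closed injective)
                                    i j (≰⇒> hi) (≰⇒> hj))
    by-degree : Dec (degree G x ≤ 2) → Dec (degree G y ≤ 2) → Dec (degree G z ≤ 2) → ⊥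
    by-degree (no hx) (no hy) _ = two-heavy zero (suc zero) (λ ()) hx hy
    by-degree (no hx) _ (no hz) = two-heavy zero (suc (suc zero)) (λ ()) hx hz
    by-degree _ (no hy) (no hz) = two-heavy (suc zero) (suc (suc zero)) (λ ()) hy hz
    by-degree (no hx) (yes dy) (yes dz) = ¬special-opposite yz dy dz (adj xy) (adj-sym zx) (inj₁ (≰⇒> hx))
    by-degree (yes dx) (no hy) (yes dz) = ¬special-opposite zx dz dx (adj yz) (adj-sym xy) (inj₁ (≰⇒> hy))
    by-degree (yes dx) (yes dy) (no hz) = ¬special-opposite xy dx dy (adj zx) (adj-sym yz) (inj₁ (≰⇒> hz))
    by-degree (yes dx) (yes dy) (yes dz)
      with least-of-three (Adjacent⇒≢ (adj xy)) (Adjacent⇒≢ (adj yz)) (Adjacent⇒≢ (adj zx))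
    ... | inj₁ x-least = ¬special-opposite yz dy dz (adj xy) (adj-sym zx) (inj₂ x-least)
    ... | inj₂ (inj₁ y-least) = ¬special-opposite zx dz dx (adj yz) (adj-sym xy) (inj₂ y-least)
    ... | inj₂ (inj₂ z-least) = ¬special-opposite xy dx dy (adj zx) (adj-sym yz) (inj₂ z-least)

  ¬odd-cycle : ∀ x xs → Closed x xs → (∀ {i j} → lookup (x ∷ xs) i ≡ lookup (x ∷ xs) j → i ≡ j) →
    parity (suc (length xs)) ≡ 1ℙ → ⊥
  ¬odd-cycle x [] (xx , _) _ _ = Adjacent⇒≢ (Ordinary⇒Adjacent xx) refl
  ¬odd-cycle x (y ∷ []) _ _ ()
  ¬odd-cycle x (y ∷ z ∷ []) closed injective _ = ¬ordinary-triangle x y z closed injective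
  ¬odd-cycle x (y ∷ z ∷ w ∷ []) _ _ ()
  ¬odd-cycle x xs@(_ ∷ _ ∷ _ ∷ _ ∷ _) closed injective odd =
    noLongOddCycle (suc (length xs)) (s≤s (s≤s (s≤s (s≤s (s≤s z≤n))))) (odd⇒%2≡1 (suc (length xs)) odd)
      (closed⇒cycle x xs (s≤s (s≤s (s≤s z≤n))) closed injective)

  -- A shortest odd closed walk is a cycle: at a repeated vertex it splits into two shorter
  -- closed walks, one of which is odd.
  ¬odd-closed-walk : ∀ x xs → Closed x xs → parity (suc (length xs)) ≡ 1ℙ → ⊥
  ¬odd-closed-walk x xs = shorter-than (suc (length xs)) x xs ≤-refl
    where
    shorter-than : ∀ N x xs → length xs < N → Closed x xs → parity (suc (length xs)) ≡ 1ℙ → ⊥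
    shorter-than (suc N) x xs (s≤s len≤N) closed odd with repetition? _≟ᶠ_ (x ∷ xs)
    ... | inj₂ injective = ¬odd-cycle x xs closed injective odd
    ... | inj₁ (as , y , bs , cs , x∷xs≡)
      with split-closed x xs as y bs cs x∷xs≡ closed | trans (cong length x∷xs≡) (length-split as y bs cs)
    ... | closed₁ , closed₂ | len≡
      with odd-sum (suc (length bs)) (suc (length (cs ++ as))) (trans (cong parity (sym len≡)) odd)
         | suc-sum⇒< len≡
    ... | inj₁ odd₁ | bs< , _ = shorter-than N y bs (≤-trans bs< len≤N) closed₁ odd₁
    ... | inj₂ odd₂ | _ , rest< = shorter-than N y (cs ++ as) (≤-trans rest< len≤N) closed₂ odd₂

  Walk : Vertex G → Vertex G → Parity → Set
  Walk r v π = ∃ λ ps → Chain r ps × lastOf r ps ≡ v × parity (length ps) ≡ π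

  walk-extend : ∀ {r u v π} → Walk r u π → Ordinary u v → Walk r v (π ⁻¹)
  walk-extend {r} {u} {v} {π} (ps , chain , last≡u , parity≡π) uv =
    ps ++ v ∷ [] ,
    Chain-++⁺ r ps (v ∷ []) chain (subst (λ z → Chain z (v ∷ [])) (sym last≡u) (uv , tt)) ,
    lastOf-++ r ps (v ∷ []) ,
    (begin
      parity (length (ps ++ v ∷ []))   ≡⟨ cong parity (length-++ ps) ⟩
      parity (length ps + 1)           ≡⟨ cong parity (+-comm (length ps) 1) ⟩
      parity (suc (length ps))         ≡⟨ parity-suc (length ps) ⟩
      parity (length ps) ⁻¹            ≡⟨ cong _⁻¹ parity≡π ⟩
      π ⁻¹                             ∎)
    where open ≡-Reasoning

  reverse-chain : ∀ x ps → Chain x ps →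
    ∃ λ qs → Chain (lastOf x ps) qs × lastOf (lastOf x ps) qs ≡ x × length qs ≡ length ps
  reverse-chain x [] _ = [] , tt , refl , refl
  reverse-chain x (p ∷ ps) (xp , chain) with reverse-chain p ps chain
  ... | qs , chain′ , last≡p , len≡ =
    qs ++ x ∷ [] ,
    Chain-++⁺ _ qs (x ∷ []) chain′ (subst (λ z → Chain z (x ∷ [])) (sym last≡p) (Ordinary-sym xp , tt)) ,
    lastOf-++ _ qs (x ∷ []) ,
    trans (length-++ qs) (trans (+-comm (length qs) 1) (cong suc len≡))

  ¬odd-closed-chain : ∀ r ws → Chain r ws → lastOf r ws ≡ r → parity (length ws) ≡ 1ℙ → ⊥
  ¬odd-closed-chain r (y ∷ ys) (ry , chain) last≡r odd =
    ¬odd-closed-walk y ys (subst (λ z → Ordinary z y) (sym last≡r) ry , chain) odd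

  ¬walks-of-both-parities : ∀ {r v π} → Walk r v π → Walk r v (π ⁻¹) → ⊥
  ¬walks-of-both-parities {r} {v} {π} (ps , chain-ps , last-ps , parity-ps)
                                       (qs , chain-qs , last-qs , parity-qs) with reverse-chain r qs chain-qs
  ... | qs′ , chain-qs′ , last-qs′ , len≡ = ¬odd-closed-chain r (ps ++ qs′)
    (Chain-++⁺ r ps qs′ chain-ps (subst (λ z → Chain z qs′) (trans last-qs (sym last-ps)) chain-qs′))
    (trans (lastOf-++ r ps qs′) (trans (cong (λ z → lastOf z qs′) (trans last-ps (sym last-qs))) last-qs′))
    (begin
      parity (length (ps ++ qs′))                  ≡⟨ cong parity (length-++ ps) ⟩
      parity (length ps + length qs′)              ≡⟨ +-homo-+ (length ps) (length qs′) ⟩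
      parity (length ps) ℙ+ parity (length qs′)    ≡⟨ cong₂ _ℙ+_ parity-ps (trans (cong parity len≡) parity-qs) ⟩
      π ℙ+ π ⁻¹                                    ≡⟨ p+p⁻¹≡1ℙ π ⟩
      1ℙ                                           ∎)
    where open ≡-Reasoning

  module ParityColouring (walk? : ∀ r v π → Dec (Walk r v π)) where

    Reachable : Vertex G → Vertex G → Set
    Reachable r v = ∃ (Walk r v)

    reachable? : ∀ r v → Dec (Reachable r v)
    reachable? r v = map′ (λ { (inj₁ w) → 0ℙ , w ; (inj₂ w) → 1ℙ , w })
                          (λ { (0ℙ , w) → inj₁ w ; (1ℙ , w) → inj₂ w })
                          (walk? r v 0ℙ ⊎-dec walk? r v 1ℙ)

    reachable-step : ∀ {r x y} → Ordinary x y → Reachable r x → Reachable r y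
    reachable-step xy (π , w) = π ⁻¹ , walk-extend w xy

    root-spec : ∀ v → ∃ λ r → Reachable r v × (∀ {j} → Reachable j v → r ≤ᶠ j)
    root-spec v = least (λ r → reachable? r v) (v , 0ℙ , [] , tt , refl , refl)

    root : Vertex G → Vertex G
    root v = proj₁ (root-spec v)

    root-cong : ∀ {x y} → Ordinary x y → root x ≡ root y
    root-cong {x} {y} xy with root-spec x | root-spec y
    ... | rx , reach-x , least-x | ry , reach-y , least-y =
      ≤-antisymᶠ (least-x (reachable-step (Ordinary-sym xy) reach-y)) (least-y (reachable-step xy reach-x))

    colour : Vertex G → Bool
    colour v = isYes (walk? (root v) v 0ℙ)

    parity-colour-proper : ∀ {r x y} → Ordinary x y → Reachable r x →
      isYes (walk? r x 0ℙ) ≢ isYes (walk? r y 0ℙ)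
    parity-colour-proper {r} {x} {y} xy (π , wx) with walk? r x 0ℙ | walk? r y 0ℙ
    ... | yes ex | yes ey = λ _ → ¬walks-of-both-parities ey (walk-extend ex xy)
    ... | yes _ | no _ = λ ()
    ... | no _ | yes _ = λ ()
    ... | no ¬ex | no ¬ey with π
    ...   | 0ℙ = λ _ → ¬ex wx
    ...   | 1ℙ = λ _ → ¬ey (walk-extend wx xy)

    colour-proper : ∀ {x y} → Ordinary x y → colour x ≢ colour y
    colour-proper {x} {y} xy cx≡cy = parity-colour-proper xy (proj₁ (proj₂ (root-spec x)))
      (trans cx≡cy (cong (λ r → isYes (walk? r y 0ℙ)) (sym (root-cong xy))))

  proper-colouring : ¬ ¬ ∃ ProperColouring
  proper-colouring no-colouring = walks-decidable λ walk? →
    no-colouring (ParityColouring.colour walk? , λ e ¬se →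
      ParityColouring.colour-proper walk? (e , ¬se , inj₁ refl))
    where
    walks-decidable : ¬ ¬ (∀ r v π → Dec (Walk r v π))
    walks-decidable = ¬¬-finite-choice λ r → ¬¬-finite-choice λ v no-decision →
      ¬¬-excluded-middle λ d₀ → ¬¬-excluded-middle λ d₁ → no-decision λ { 0ℙ → d₀ ; 1ℙ → d₁ }

-- A proper colouring is only shown to exist under ¬¬, but one can be found by exhaustive search.
sufficiency : ∀ G → NoLongOddCycle G → TriangleCondition G → MatchingsIntersectionOfTwoMatroids G
sufficiency G noLongOddCycle triangleCondition = from-search (anySubset? (properColouring? ∘ lookupᵛ))
  where
  open SpecialEdges G
  from-search : Dec (∃ λ c → ProperColouring (lookupᵛ c)) → MatchingsIntersectionOfTwoMatroids G
  from-search (yes (c , proper)) = PartitionByColouring.matchings-intersection G (lookupᵛ c) proper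
  from-search (no ¬proper) = ⊥-elim (OddClosedWalks.proper-colouring G noLongOddCycle triangleCondition
    λ (col , proper) → ¬proper (tabulate col , ProperColouring-resp (λ v → sym (lookup∘tabulate col v)) proper))

theorem2 : (G : Graph) →
    MatchingsIntersectionOfTwoMatroids G ⇔ (NoLongOddCycle G × TriangleCondition G)
theorem2 G = mk⇔ necessary (λ (noLongOddCycle , triangleCondition) →
                             sufficiency G noLongOddCycle triangleCondition)
  where
  necessary : MatchingsIntersectionOfTwoMatroids G → NoLongOddCycle G × TriangleCondition G
  necessary (M₁ , M₂ , isM₁ , isM₂ , matchings) = noLongOddCycle , triangleCondition
    where open Necessity G isM₁ isM₂ matchings
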